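{- For every integer $t\geq 1$, every graph that does not contain $K^*_{2,t}$ as a minor is $2$-colourable with defect $2t-2$.
   Context: All graphs are finite and simple. $K^*_{s,t}$ denotes the complete join of $K_s$ and the edgeless graph $\overline{K_t}$, i.e. the graph on $s+t$ vertices consisting of a clique of size $s$ together with $t$ pairwise non-adjacent vertices each adjacent to all vertices of the clique. A graph is $k$-colourable with defect $d$ if its vertices can be assigned one of $k$ colours (not necessarily properly) so that each vertex has at most $d$ neighbours of its own colour. -}

module Defs where

open import Data.Nat using (ℕ; _<ᵇ_; _≤_)
open import Data.Bool using (Bool; true; false; not; _∧_; _∨_)
open import Data.Fin using (Fin; toℕ; _≟_)
open import Data.List using (List; length; filter; allFin)
open import Data.Maybe using (Maybe; just)
open import Data.Product using (Σ; ∃; ∃-syntax; _×_)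
open import Relation.Binary.PropositionalEquality using (_≡_; refl) renaming (sym to sym≡)
open import Relation.Nullary using (yes; no)
open import Data.Empty using (⊥-elim)
open import Data.Bool.Properties using (∨-comm)
open import Relation.Nullary.Decidable using (⌊_⌋)

record Graph : Set where
  field
    size  : ℕ
    adj   : Fin size → Fin size → Bool
    sym   : ∀ x y → adj x y ≡ adj y x
    irrefl : ∀ x → adj x x ≡ false
open Graph public

-- K*_{s,t}: vertices 0..s-1 form a clique, vertices s..s+t-1 are
-- pairwise non-adjacent and adjacent to every clique vertex.
kstarAdj : (s t : ℕ) → Fin (s Data.Nat.+ t) → Fin (s Data.Nat.+ t) → Bool
kstarAdj s t i j = not ⌊ i ≟ j ⌋ ∧ ((toℕ i <ᵇ s) ∨ (toℕ j <ᵇ s))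

data WalkIn (G : Graph) (S : Fin (size G) → Set) : Fin (size G) → Fin (size G) → Set where
  here : ∀ {x} → S x → WalkIn G S x x
  step : ∀ {x y z} → S x → adj G x y ≡ true → WalkIn G S y z → WalkIn G S x z

-- A minor model of H in G: each vertex x of G is either deleted (nothing)
-- or assigned to the branch set of exactly one vertex of H (so branch sets
-- are pairwise disjoint).
record MinorModel (H G : Graph) : Set where
  field
    branch    : Fin (size G) → Maybe (Fin (size H))
    nonempty  : ∀ v → ∃[ x ] (branch x ≡ just v)
    connected : ∀ v x y → branch x ≡ just v → branch y ≡ just v →
                WalkIn G (λ z → branch z ≡ just v) x y
    edges     : ∀ u v → adj H u v ≡ true →
                ∃[ x ] ∃[ y ] (branch x ≡ just u × branch y ≡ just v × adj G x y ≡ true)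

_≼_ : Graph → Graph → Set
H ≼ G = MinorModel H G

monoDeg : (G : Graph) {k : ℕ} → (Fin (size G) → Fin k) → Fin (size G) → ℕ
monoDeg G c x = length (filter (λ y → adj G x y Data.Bool.≟ true) (filter (λ y → c x ≟ c y) (allFin (size G))))

DefectColourable : ℕ → ℕ → Graph → Set
DefectColourable k d G = Σ (Fin (size G) → Fin k) λ c → ∀ x → monoDeg G c x ≤ d

private
  ≟-sym : ∀ {n} (i j : Fin n) → ⌊ i ≟ j ⌋ ≡ ⌊ j ≟ i ⌋
  ≟-sym i j with i ≟ j | j ≟ i
  ... | yes _ | yes _ = refl
  ... | no _ | no _ = refl
  ... | yes p | no q = ⊥-elim (q (sym≡ p))
  ... | no p | yes q = ⊥-elim (p (sym≡ q))

  ≟-self : ∀ {n} (i : Fin n) → ⌊ i ≟ i ⌋ ≡ true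
  ≟-self i with i ≟ i
  ... | yes _ = refl
  ... | no p = ⊥-elim (p refl)

kstarSym : (s t : ℕ) → ∀ i j → kstarAdj s t i j ≡ kstarAdj s t j i
kstarSym s t i j rewrite ≟-sym i j | ∨-comm (toℕ i <ᵇ s) (toℕ j <ᵇ s) = refl

kstarIrr : (s t : ℕ) → ∀ i → kstarAdj s t i i ≡ false
kstarIrr s t i rewrite ≟-self i = refl

Kstar : ℕ → ℕ → Graph
Kstar s t = record { size = s Data.Nat.+ t ; adj = kstarAdj s t ; sym = kstarSym s t ; irrefl = kstarIrr s t }

-- Colour every vertex by the parity of its distance from a fixed root of its
-- component.  Distances along an edge differ by at most one, so a monochromatic
-- edge joins two vertices x, w of the same layer i + 1.  If x has t such
-- neighbours w₁, …, w_t, contract the ball of radius i around the root (it is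
-- connected, and x and every wⱼ have a neighbour in it) to one vertex; together
-- with x it forms the clique of a K*_{2,t} minor whose independent side is
-- {w₁, …, w_t}.  So excluding K*_{2,t} bounds the defect by t − 1 ≤ 2t − 2.
module Submission where

open import Defs
open import Data.Nat using (ℕ; _≤_; _*_; _∸_)
open import Relation.Nullary using (¬_)

open import Data.Bool as Bool using (Bool; true; false; _∧_; _∨_; if_then_else_)
open import Data.Bool.Properties using (∧-conicalˡ; ∧-conicalʳ; ∧-zeroʳ; ∨-zeroʳ; ¬-not; ⇔→≡)
open import Data.Fin using (Fin; zero; suc; _≟_)
open import Data.Fin.Properties using (any?)
open import Data.Fin.Subset using (Subset; _∈_; ∣_∣)
open import Data.Fin.Subset.Properties using (p⊂q⇒∣p∣<∣q∣; ∣p∣≤n)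
open import Data.List using (List; []; _∷_; length; filter; findᵇ; allFin)
open import Data.List.Membership.Propositional using () renaming (_∈_ to _∈ˡ_)
open import Data.List.Membership.Propositional.Properties using (∈-filter⁻; ∈-allFin)
open import Data.List.Relation.Unary.Any using (here; there)
open import Data.List.Relation.Unary.AllPairs using (_∷_)
open import Data.List.Relation.Unary.Unique.Propositional using (Unique)
open import Data.List.Relation.Unary.Unique.Propositional.Properties
  using (allFin⁺; filter⁺; Unique[x∷xs]⇒x∉xs)
open import Data.Maybe as Maybe using (Maybe; just; nothing)
open import Data.Maybe.Properties using (just-injective)
open import Data.Nat using (zero; suc; _+_; _<_; z≤n; s≤s; parity)
open import Data.Nat.GeneralisedArithmetic using (fold)
open import Data.Nat.Properties
  using (≤-refl; ≤-trans; ≤-<-trans; n≮n; ≤⇒≯; ≮⇒≥; <-cmp; ≤-antisym; m≤n*m; *-distribˡ-∸)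
open import Data.Parity using (Parity; 0ℙ; 1ℙ)
open import Data.Parity.Properties using (p≢p⁻¹; suc-homo-⁻¹)
open import Data.Product using (Σ; ∃-syntax; _×_; _,_; proj₁; proj₂)
open import Data.Sum using (_⊎_; inj₁; inj₂)
open import Data.Vec using (tabulate)
open import Data.Vec.Properties using (lookup∘tabulate; lookup⇒[]=; []=⇒lookup)
open import Function using (_∘_; mk⇔)
open import Function.Definitions using (Injective)
open import Relation.Binary.Definitions using (tri<; tri≈; tri>)
open import Relation.Binary.PropositionalEquality as ≡
  using (_≡_; _≢_; refl; trans; cong; cong₂; subst)
open import Relation.Nullary using (Dec; yes; no; does; contradiction)
open import Relation.Nullary.Decidable using (dec-true; dec-false; _×-dec_)

dec-true⁻ : ∀ {p} {P : Set p} (P? : Dec P) → does P? ≡ true → P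
dec-true⁻ (yes p) _ = p

-- The least k < m with f k, or m if there is none.
least : (ℕ → Bool) → ℕ → ℕ
least f zero = zero
least f (suc m) = if f 0 then 0 else suc (least (f ∘ suc) m)

least-≤ : ∀ (f : ℕ → Bool) m {k} → f k ≡ true → least f m ≤ k
least-≤ f zero _ = z≤n
least-≤ f (suc m) fk with f 0 in f0
... | true = z≤n
least-≤ f (suc m) {zero} fk | false = contradiction (trans (≡.sym fk) f0) λ ()
least-≤ f (suc m) {suc k} fk | false = s≤s (least-≤ (f ∘ suc) m fk)

least-holds : ∀ (f : ℕ → Bool) m {k} → f k ≡ true → k ≤ m → f (least f m) ≡ true
least-holds f zero fk z≤n = fk
least-holds f (suc m) fk k≤m with f 0 in f0
... | true = f0
least-holds f (suc m) {zero} fk k≤m | false = contradiction (trans (≡.sym fk) f0) λ ()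
least-holds f (suc m) {suc k} fk (s≤s k≤m) | false = least-holds (f ∘ suc) m fk k≤m

module _ {a} {A : Set a} where

  findᵇ-cong : ∀ {f g : A → Bool} → (∀ x → f x ≡ g x) → ∀ xs → findᵇ f xs ≡ findᵇ g xs
  findᵇ-cong f≗g [] = refl
  findᵇ-cong f≗g (x ∷ xs) rewrite f≗g x | findᵇ-cong f≗g xs = refl

  findᵇ-holds : ∀ (f : A → Bool) xs {y} → findᵇ f xs ≡ just y → f y ≡ true
  findᵇ-holds f (x ∷ xs) e with f x in fx
  findᵇ-holds f (x ∷ xs) refl | true = fx
  ... | false = findᵇ-holds f xs e

  findᵇ-succeeds : ∀ (f : A → Bool) {xs y} → y ∈ˡ xs → f y ≡ true →
                   ∃[ z ] findᵇ f xs ≡ just z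
  findᵇ-succeeds f {x ∷ xs} y∈ fy with f x in fx
  ... | true = x , refl
  findᵇ-succeeds f {x ∷ xs} (here refl) fy | false = contradiction (trans (≡.sym fy) fx) λ ()
  findᵇ-succeeds f {x ∷ xs} (there y∈) fy | false = findᵇ-succeeds f y∈ fy

  pickDistinct : ∀ {xs : List A} → Unique xs → ∀ {t} → t ≤ length xs →
                 Σ (Fin t → A) λ f → Injective _≡_ _≡_ f × (∀ j → f j ∈ˡ xs)
  pickDistinct _ {zero} _ = (λ ()) , (λ {i} → contradiction i λ ()) , λ ()
  pickDistinct {x ∷ xs} (x∉xs ∷ unique) {suc t} (s≤s t≤) = f , f-injective , f-∈
    where
    rest = pickDistinct unique t≤
    f : Fin (suc t) → A
    f zero = x
    f (suc j) = proj₁ rest j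
    fresh : ∀ j → x ≢ proj₁ rest j
    fresh j e = Unique[x∷xs]⇒x∉xs (x∉xs ∷ unique)
                  (subst (_∈ˡ xs) (≡.sym e) (proj₂ (proj₂ rest) j))
    f-injective : Injective _≡_ _≡_ f
    f-injective {zero} {zero} _ = refl
    f-injective {zero} {suc j} e = contradiction e (fresh j)
    f-injective {suc i} {zero} e = contradiction (≡.sym e) (fresh i)
    f-injective {suc i} {suc j} e = cong suc (proj₁ (proj₂ rest) e)
    f-∈ : ∀ j → f j ∈ˡ x ∷ xs
    f-∈ zero = here refl
    f-∈ (suc j) = there (proj₂ (proj₂ rest) j)

parity-suc≢ : ∀ n → parity (suc n) ≢ parity n
parity-suc≢ n e = p≢p⁻¹ (parity (suc n)) (trans e (≡.sym (suc-homo-⁻¹ n)))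

parity-injective-≤1 : ∀ {a b} → b ≤ suc a → a ≤ suc b → parity a ≡ parity b → a ≡ b
parity-injective-≤1 {a} {b} b≤1+a a≤1+b same with <-cmp a b
... | tri≈ _ a≡b _ = a≡b
... | tri< a<b _ _ with ≤-antisym b≤1+a a<b
...   | refl = contradiction (≡.sym same) (parity-suc≢ a)
parity-injective-≤1 {a} {b} b≤1+a a≤1+b same | tri> _ _ b<a with ≤-antisym a≤1+b b<a
...   | refl = contradiction same (parity-suc≢ b)

parityColour : Parity → Fin 2
parityColour 0ℙ = zero
parityColour 1ℙ = suc zero

parityColour-injective : Injective _≡_ _≡_ parityColour
parityColour-injective {0ℙ} {0ℙ} _ = refl
parityColour-injective {1ℙ} {1ℙ} _ = refl

_⊆ᵇ_ : ∀ {n} → (Fin n → Bool) → (Fin n → Bool) → Set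
P ⊆ᵇ Q = ∀ x → P x ≡ true → Q x ≡ true

toSubset : ∀ {n} → (Fin n → Bool) → Subset n
toSubset = tabulate

module _ {n} {P : Fin n → Bool} where

  ∈-toSubset⁺ : ∀ {x} → P x ≡ true → x ∈ toSubset P
  ∈-toSubset⁺ {x} Px = lookup⇒[]= x (tabulate P) (trans (lookup∘tabulate P x) Px)

  ∈-toSubset⁻ : ∀ {x} → x ∈ toSubset P → P x ≡ true
  ∈-toSubset⁻ {x} x∈P = trans (≡.sym (lookup∘tabulate P x)) ([]=⇒lookup x∈P)

∣toSubset∣-< : ∀ {n} {P Q : Fin n → Bool} → P ⊆ᵇ Q → ∀ x → Q x ≡ true → P x ≡ false →
               ∣ toSubset P ∣ < ∣ toSubset Q ∣
∣toSubset∣-< P⊆Q x Qx Px = p⊂q⇒∣p∣<∣q∣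
  ( (λ {y} y∈P → ∈-toSubset⁺ (P⊆Q y (∈-toSubset⁻ y∈P)))
  , x , ∈-toSubset⁺ Qx
  , λ x∈P → contradiction (trans (≡.sym (∈-toSubset⁻ x∈P)) Px) λ ())

-- Once a step of the chain P₀ ⊆ F P₀ ⊆ F² P₀ ⊆ ⋯ adds nothing, no later step
-- does (by monotonicity); until then every step adds an element of Fin n.
module Saturation {n : ℕ} (F : (Fin n → Bool) → Fin n → Bool)
                  (F-monotone : ∀ {P Q} → P ⊆ᵇ Q → F P ⊆ᵇ F Q)
                  (F-inflationary : ∀ P → P ⊆ᵇ F P) (P₀ : Fin n → Bool) where

  chain : ℕ → Fin n → Bool
  chain = fold P₀ F

  Stable : ℕ → Set
  Stable k = chain (suc k) ⊆ᵇ chain k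

  stable-or-grows : ∀ k → Stable k ⊎ ∣ toSubset (chain k) ∣ < ∣ toSubset (chain (suc k)) ∣
  stable-or-grows k with any? (λ x → (chain (suc k) x Bool.≟ true) ×-dec (chain k x Bool.≟ false))
  ... | yes (x , new , notOld) = inj₂ (∣toSubset∣-< (F-inflationary (chain k)) x new notOld)
  ... | no noNew = inj₁ λ x new → ¬-not λ notOld → noNew (x , new , notOld)

  stable-or-long : ∀ k → Stable k ⊎ k < ∣ toSubset (chain (suc k)) ∣
  stable-or-long zero with stable-or-grows zero
  ... | inj₁ stable = inj₁ stable
  ... | inj₂ grows = inj₂ (≤-<-trans z≤n grows)
  stable-or-long (suc k) with stable-or-long k
  ... | inj₁ stable = inj₁ (F-monotone stable)
  ... | inj₂ long with stable-or-grows (suc k)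
  ...   | inj₁ stable = inj₁ stable
  ...   | inj₂ grows = inj₂ (≤-<-trans long grows)

  saturated : Stable n
  saturated with stable-or-long n
  ... | inj₁ stable = stable
  ... | inj₂ long = contradiction long (≤⇒≯ (∣p∣≤n (toSubset (chain (suc n)))))

adj-sym : ∀ G {x y} → adj G x y ≡ true → adj G y x ≡ true
adj-sym G {x} {y} e = trans (sym G y x) e

adj⇒≢ : ∀ G {x y} → adj G x y ≡ true → x ≢ y
adj⇒≢ G {x} e refl = contradiction (trans (≡.sym e) (irrefl G x)) λ ()

module _ {G : Graph} {S : Fin (size G) → Set} where

  _++ʷ_ : ∀ {x y z} → WalkIn G S x y → WalkIn G S y z → WalkIn G S x z
  here _ ++ʷ q = q
  step s e p ++ʷ q = step s e (p ++ʷ q)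

  source : ∀ {x y} → WalkIn G S x y → S x
  source (here s) = s
  source (step s _ _) = s

  reverseʷ : ∀ {x y} → WalkIn G S x y → WalkIn G S y x
  reverseʷ (here s) = here s
  reverseʷ (step s e p) = reverseʷ p ++ʷ step (source p) (adj-sym G e) (here s)

weakenʷ : ∀ {G} {S T : Fin (size G) → Set} {x y} → (∀ {z} → S z → T z) →
          WalkIn G S x y → WalkIn G T x y
weakenʷ S⊆T (here s) = here (S⊆T s)
weakenʷ S⊆T (step s e p) = step (S⊆T s) e (weakenʷ S⊆T p)

NeighbourIn : (G : Graph) → (Fin (size G) → Bool) → Fin (size G) → Set
NeighbourIn G P x = ∃[ y ] (P y ≡ true × adj G y x ≡ true)

-- Contracting a connected set X and deleting everything outside X, v and the
-- w j leaves K*_{2,t} with X and v as the clique.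
module Contraction (G : Graph) (t : ℕ) (X : Fin (size G) → Bool)
  (X-connected : ∀ {x y} → X x ≡ true → X y ≡ true → WalkIn G (λ z → X z ≡ true) x y)
  (v : Fin (size G)) (w : Fin t → Fin (size G)) (w-injective : Injective _≡_ _≡_ w)
  (v∉X : X v ≡ false) (w∉X : ∀ j → X (w j) ≡ false) (v-w : ∀ j → adj G v (w j) ≡ true)
  (v-X : NeighbourIn G X v) (w-X : ∀ j → NeighbourIn G X (w j)) where

  index : Fin (size G) → Maybe (Fin t)
  index z with any? (λ j → w j ≟ z)
  ... | yes (j , _) = just j
  ... | no _ = nothing

  index-sound : ∀ {z j} → index z ≡ just j → w j ≡ z
  index-sound {z} e with any? (λ j → w j ≟ z)
  index-sound {z} refl | yes (j , wj≡z) = wj≡z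

  index-w : ∀ j → index (w j) ≡ just j
  index-w j with any? (λ i → w i ≟ w j)
  ... | yes (i , wi≡wj) = cong just (w-injective wi≡wj)
  ... | no none = contradiction (j , refl) none

  place : Bool → Bool → Maybe (Fin t) → Maybe (Fin (2 + t))
  place true _ _ = just zero
  place false true _ = just (suc zero)
  place false false m = Maybe.map (λ j → suc (suc j)) m

  place-true : ∀ {b c m} → b ≡ true → place b c m ≡ just zero
  place-true refl = refl

  place-false-true : ∀ {b c m} → b ≡ false → c ≡ true → place b c m ≡ just (suc zero)
  place-false-true refl refl = refl

  place-false-false : ∀ {b c m j} → b ≡ false → c ≡ false → m ≡ just j →
                      place b c m ≡ just (suc (suc j))
  place-false-false refl refl refl = refl

  place-zero⁻ : ∀ {b c m} → place b c m ≡ just zero → b ≡ true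
  place-zero⁻ {true} _ = refl
  place-zero⁻ {false} {true} ()
  place-zero⁻ {false} {false} {just _} ()

  place-one⁻ : ∀ {b c m} → place b c m ≡ just (suc zero) → c ≡ true
  place-one⁻ {false} {true} _ = refl
  place-one⁻ {false} {false} {just _} ()

  place-suc-suc⁻ : ∀ {b c m j} → place b c m ≡ just (suc (suc j)) → m ≡ just j
  place-suc-suc⁻ {false} {false} {just _} refl = refl

  branch : Fin (size G) → Maybe (Fin (2 + t))
  branch z = place (X z) (does (z ≟ v)) (index z)

  branch-X : ∀ {z} → X z ≡ true → branch z ≡ just zero
  branch-X = place-true

  branch-v : branch v ≡ just (suc zero)
  branch-v = place-false-true v∉X (dec-true (v ≟ v) refl)

  branch-w : ∀ j → branch (w j) ≡ just (suc (suc j))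
  branch-w j =
    place-false-false (w∉X j) (dec-false (w j ≟ v) (adj⇒≢ G (v-w j) ∘ ≡.sym)) (index-w j)

  branch-zero⁻ : ∀ {z} → branch z ≡ just zero → X z ≡ true
  branch-zero⁻ {z} = place-zero⁻ {X z} {does (z ≟ v)} {index z}

  branch-one⁻ : ∀ {z} → branch z ≡ just (suc zero) → z ≡ v
  branch-one⁻ {z} = dec-true⁻ (z ≟ v) ∘ place-one⁻ {X z} {does (z ≟ v)} {index z}

  branch-suc-suc⁻ : ∀ {z j} → branch z ≡ just (suc (suc j)) → w j ≡ z
  branch-suc-suc⁻ {z} = index-sound ∘ place-suc-suc⁻ {X z} {does (z ≟ v)} {index z}

  Linked : Fin (2 + t) → Fin (2 + t) → Set
  Linked h h' = ∃[ x ] ∃[ y ] (branch x ≡ just h × branch y ≡ just h' × adj G x y ≡ true)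

  Linked-sym : ∀ {h h'} → Linked h h' → Linked h' h
  Linked-sym (x , y , bx , by , e) = y , x , by , bx , adj-sym G e

  X-linked : ∀ {z h} → NeighbourIn G X z → branch z ≡ just h → Linked zero h
  X-linked {z} (y , Xy , e) bz = y , z , branch-X Xy , bz , e

  minor : Kstar 2 t ≼ G
  minor = record { branch = branch ; nonempty = nonempty ; connected = connected ; edges = edges }
    where
    nonempty : ∀ h → ∃[ x ] branch x ≡ just h
    nonempty zero = proj₁ v-X , branch-X (proj₁ (proj₂ v-X))
    nonempty (suc zero) = v , branch-v
    nonempty (suc (suc j)) = w j , branch-w j

    connected : ∀ h x y → branch x ≡ just h → branch y ≡ just h →
                WalkIn G (λ z → branch z ≡ just h) x y
    connected zero x y bx by = weakenʷ branch-X (X-connected (branch-zero⁻ bx) (branch-zero⁻ by))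
    connected (suc zero) x y bx by with branch-one⁻ bx | branch-one⁻ by
    ... | refl | refl = here bx
    connected (suc (suc j)) x y bx by with branch-suc-suc⁻ bx | branch-suc-suc⁻ by
    ... | refl | refl = here bx

    edges : ∀ h h' → adj (Kstar 2 t) h h' ≡ true → Linked h h'
    edges zero zero ()
    edges zero (suc zero) _ = X-linked v-X branch-v
    edges zero (suc (suc j)) _ = X-linked (w-X j) (branch-w j)
    edges (suc zero) zero _ = Linked-sym (X-linked v-X branch-v)
    edges (suc zero) (suc zero) ()
    edges (suc zero) (suc (suc j)) _ = v , w j , branch-v , branch-w j , v-w j
    edges (suc (suc j)) zero _ = Linked-sym (X-linked (w-X j) (branch-w j))
    edges (suc (suc j)) (suc zero) _ = Linked-sym (v , w j , branch-v , branch-w j , v-w j)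
    edges (suc (suc j)) (suc (suc k)) e = contradiction (trans (≡.sym (∧-zeroʳ _)) e) λ ()

monochromatic-neighbours : ∀ G {k} (c : Fin (size G) → Fin k) x {t} → t < monoDeg G c x →
  Σ (Fin (suc t) → Fin (size G)) λ w →
    Injective _≡_ _≡_ w × (∀ j → adj G x (w j) ≡ true × c x ≡ c (w j))
monochromatic-neighbours G c x t<deg =
  proj₁ picked , proj₁ (proj₂ picked) , λ j → properties (proj₂ (proj₂ picked) j)
  where
  sameColour = λ y → c x ≟ c y
  adjacent = λ y → adj G x y Bool.≟ true
  picked = pickDistinct (filter⁺ adjacent (filter⁺ sameColour (allFin⁺ (size G)))) t<deg
  properties : ∀ {y} → y ∈ˡ filter adjacent (filter sameColour (allFin (size G))) →
               adj G x y ≡ true × c x ≡ c y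
  properties y∈ with ∈-filter⁻ adjacent {xs = filter sameColour (allFin (size G))} y∈
  ... | y∈′ , x-y = x-y , proj₂ (∈-filter⁻ sameColour {xs = allFin (size G)} y∈′)

module BreadthFirst (G : Graph) where

  expand : (Fin (size G) → Bool) → Fin (size G) → Bool
  expand P x = P x ∨ does (any? λ y → (P y ∧ adj G y x) Bool.≟ true)

  expand-inflationary : ∀ P → P ⊆ᵇ expand P
  expand-inflationary P x Px rewrite Px = refl

  expand-adj : ∀ {P x y} → P y ≡ true → adj G y x ≡ true → expand P x ≡ true
  expand-adj {P} {x} {y} Py e =
    trans (cong (P x ∨_) (dec-true (any? _) (y , cong₂ _∧_ Py e))) (∨-zeroʳ (P x))

  expand⁻ : ∀ {P x} → expand P x ≡ true → P x ≡ true ⊎ NeighbourIn G P x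
  expand⁻ {P} {x} e with P x | any? (λ y → (P y ∧ adj G y x) Bool.≟ true)
  ... | true | _ = inj₁ refl
  ... | false | yes (y , both) = inj₂ (y , ∧-conicalˡ _ _ both , ∧-conicalʳ _ _ both)

  expand-monotone : ∀ {P Q} → P ⊆ᵇ Q → expand P ⊆ᵇ expand Q
  expand-monotone P⊆Q x e with expand⁻ e
  ... | inj₁ Px = expand-inflationary _ x (P⊆Q x Px)
  ... | inj₂ (y , Py , e′) = expand-adj (P⊆Q y Py) e′

  ball : Fin (size G) → ℕ → Fin (size G) → Bool
  ball a = fold (λ x → does (a ≟ x)) expand

  module _ (a : Fin (size G)) where

    ball-suc : ∀ k {x} → ball a k x ≡ true → ball a (suc k) x ≡ true
    ball-suc k {x} = expand-inflationary (ball a k) x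

    ball-centre : ∀ k → ball a k a ≡ true
    ball-centre zero = dec-true (a ≟ a) refl
    ball-centre (suc k) = ball-suc k (ball-centre k)

    ball-closed : ∀ {x y} → ball a (size G) x ≡ true → adj G x y ≡ true →
                  ball a (size G) y ≡ true
    ball-closed {y = y} bx e =
      Saturation.saturated expand expand-monotone expand-inflationary (λ x → does (a ≟ x))
        y (expand-adj bx e)

    walk-to-centre : ∀ k {x} → ball a k x ≡ true → WalkIn G (λ z → ball a k z ≡ true) x a
    walk-to-centre zero {x} bx with dec-true⁻ (a ≟ x) bx
    ... | refl = here bx
    walk-to-centre (suc k) bx with expand⁻ bx
    ... | inj₁ bx′ = weakenʷ (ball-suc k) (walk-to-centre k bx′)
    ... | inj₂ (y , by , e) = step bx (adj-sym G e) (weakenʷ (ball-suc k) (walk-to-centre k by))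

    ball-connected : ∀ k {x y} → ball a k x ≡ true → ball a k y ≡ true →
                     WalkIn G (λ z → ball a k z ≡ true) x y
    ball-connected k bx by = walk-to-centre k bx ++ʷ reverseʷ (walk-to-centre k by)

    level : Fin (size G) → ℕ
    level x = least (λ k → ball a k x) (size G)

    ball-level : ∀ {x} → ball a (size G) x ≡ true → ball a (level x) x ≡ true
    ball-level {x} bx = least-holds (λ k → ball a k x) (size G) bx ≤-refl

    level-≤ : ∀ {x k} → ball a k x ≡ true → level x ≤ k
    level-≤ {x} = least-≤ (λ k → ball a k x) (size G)

    level-adj : ∀ {x y} → ball a (size G) x ≡ true → adj G x y ≡ true →
                level y ≤ suc (level x)
    level-adj bx e = level-≤ (expand-adj (ball-level bx) e)

    level-zero⁻ : ∀ {x} → ball a (size G) x ≡ true → level x ≡ 0 → a ≡ x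
    level-zero⁻ {x} bx l≡0 =
      dec-true⁻ (a ≟ x) (subst (λ k → ball a k x ≡ true) l≡0 (ball-level bx))

    layer-outside : ∀ {x i} → level x ≡ suc i → ball a i x ≡ false
    layer-outside {x} {i} l≡1+i =
      ¬-not λ bx → contradiction (subst (_≤ i) l≡1+i (level-≤ {x} {i} bx)) (n≮n i)

    layer-neighbour : ∀ {x i} → ball a (size G) x ≡ true → level x ≡ suc i →
                      NeighbourIn G (ball a i) x
    layer-neighbour {x} bx l≡1+i
      with expand⁻ (subst (λ k → ball a k x ≡ true) l≡1+i (ball-level bx))
    ... | inj₁ inside = contradiction (trans (≡.sym inside) (layer-outside l≡1+i)) λ ()
    ... | inj₂ neighbour = neighbour

  root-search : ∀ x → ∃[ r ] findᵇ (λ a → ball a (size G) x) (allFin (size G)) ≡ just r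
  root-search x = findᵇ-succeeds (λ a → ball a (size G) x) (∈-allFin x) (ball-centre x (size G))

  root : Fin (size G) → Fin (size G)
  root x = proj₁ (root-search x)

  root-found : ∀ x → findᵇ (λ a → ball a (size G) x) (allFin (size G)) ≡ just (root x)
  root-found x = proj₂ (root-search x)

  ball-root : ∀ x → ball (root x) (size G) x ≡ true
  ball-root x = findᵇ-holds (λ a → ball a (size G) x) (allFin (size G)) (root-found x)

  root-adj : ∀ {x y} → adj G x y ≡ true → root x ≡ root y
  root-adj {x} {y} e =
    just-injective (trans (≡.sym (root-found x))
                          (trans (findᵇ-cong same-ball (allFin (size G))) (root-found y)))
    where
    same-ball : ∀ a → ball a (size G) x ≡ ball a (size G) y
    same-ball a = ⇔→≡ (mk⇔ (λ bx → ball-closed a bx e) (λ by → ball-closed a by (adj-sym G e)))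

  colour : Fin (size G) → Fin 2
  colour x = parityColour (parity (level (root x) x))

  monochromatic-edge-level : ∀ {x y} → adj G x y ≡ true → colour x ≡ colour y →
                             level (root x) y ≡ level (root x) x
  monochromatic-edge-level {x} {y} e same =
    parity-injective-≤1 (level-adj r by (adj-sym G e)) (level-adj r bx e) parities
    where
    r = root x
    bx = ball-root x
    by = ball-closed r bx e
    parities : parity (level r y) ≡ parity (level r x)
    parities = subst (λ r′ → parity (level r′ y) ≡ parity (level r x))
                     (≡.sym (root-adj e)) (≡.sym (parityColour-injective same))

  monochromatic-fan⇒minor : ∀ {t} x (w : Fin (suc t) → Fin (size G)) → Injective _≡_ _≡_ w →
    (∀ j → adj G x (w j) ≡ true × colour x ≡ colour (w j)) → Kstar 2 (suc t) ≼ G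
  monochromatic-fan⇒minor {t} x w w-injective fan = fan-minor (level r x) refl
    where
    r = root x
    bx = ball-root x
    bw : ∀ j → ball r (size G) (w j) ≡ true
    bw j = ball-closed r bx (proj₁ (fan j))
    level-w : ∀ {l} → level r x ≡ l → ∀ j → level r (w j) ≡ l
    level-w lx j = trans (monochromatic-edge-level (proj₁ (fan j)) (proj₂ (fan j))) lx
    fan-minor : ∀ l → level r x ≡ l → Kstar 2 (suc t) ≼ G
    fan-minor zero lx =
      contradiction (trans (≡.sym (level-zero⁻ r bx lx))
                           (level-zero⁻ r (bw zero) (level-w lx zero)))
                    (adj⇒≢ G (proj₁ (fan zero)))
    fan-minor (suc i) lx =
      Contraction.minor G (suc t) (ball r i) (ball-connected r i) x w w-injective
        (layer-outside r lx) (λ j → layer-outside r (level-w lx j)) (proj₁ ∘ fan)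
        (layer-neighbour r bx lx) (λ j → layer-neighbour r (bw j) (level-w lx j))

  defect-bound : ∀ t → ¬ (Kstar 2 (suc t) ≼ G) → ∀ x → monoDeg G colour x ≤ t
  defect-bound t no-minor x = ≮⇒≥ λ t<deg →
    let (w , w-injective , fan) = monochromatic-neighbours G colour x t<deg
    in no-minor (monochromatic-fan⇒minor x w w-injective fan)

theorem15 : (t : ℕ) → 1 ≤ t → (G : Graph) → ¬ (Kstar 2 t ≼ G) →
            DefectColourable 2 (2 * t ∸ 2) G
theorem15 (suc t) _ G no-minor =
  colour , λ x → ≤-trans (defect-bound t no-minor x) t≤2[1+t]∸2
  where
  open BreadthFirst G
  t≤2[1+t]∸2 : t ≤ 2 * suc t ∸ 2
  t≤2[1+t]∸2 = subst (t ≤_) (*-distribˡ-∸ 2 (suc t) 1) (m≤n*m t 2)
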